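{- Let $D$ be the derivation of the polynomial ring $\mathbb Q[L,M,s,x,y]$ determined by $D(L)=Ly$, $D(M)=Ms$, $D(s)=xy$, $D(x)=xy$, $D(y)=xy$ (and $D(c)=0$ for constants). Then for every $n\ge0$, $$D^n(LM)=LM\,A_{n+1}(x,y,s).$$
   Context: For $\pi\in\mathfrak S_n$: ${\rm des}(\pi)=\#\{i\in[n-1]:\pi(i)>\pi(i+1)\}$, ${\rm suc}(\pi)=\#\{i\in[n-1]:\pi(i+1)=\pi(i)+1\}$, ${\rm basc}(\pi)=\#\{i\in[n-1]:\pi(i+1)\ge\pi(i)+2\}$. $A_n(x,y,s)=\sum_{\pi\in\mathfrak S_n}x^{{\rm basc}(\pi)}y^{{\rm des}(\pi)}s^{{\rm suc}(\pi)}$. A derivation is a linear map with $D(uv)=D(u)v+uD(v)$. -}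

module Defs where

open import Data.Nat using (ℕ; zero; suc; _+_; _∸_; _≡ᵇ_; _<ᵇ_)
open import Data.Bool using (Bool; true; false; _∧_; if_then_else_; not)
open import Data.Integer using (+_)
open import Data.Rational using (ℚ; 0ℚ; 1ℚ; _/_) renaming (_+_ to _+ℚ_; _*_ to _*ℚ_)
open import Data.Fin using (Fin; zero; suc)
open import Data.Vec using (Vec; []; _∷_; lookup; zipWith; updateAt; tabulate; allFin; toList)
open import Data.List using (List; []; _∷_; map; concatMap; filter; foldr; upTo; _++_; length)
open import Data.Product using (_×_; _,_; proj₁; proj₂)
open import Function using (_∘_)
open import Relation.Binary.PropositionalEquality using (_≡_)

-- Variables are indexed by Fin 5 in the order  L , M , s , x , y .
-- A monomial is its exponent vector; a polynomial is a finite formal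
-- sum (list) of terms  c · monomial.  Two polynomials are equal iff
-- every monomial has the same coefficient in both (_≈P_).

Var : Set
Var = Fin 5

vL vM vs vx vy : Var
vL = zero
vM = suc zero
vs = suc (suc zero)
vx = suc (suc (suc zero))
vy = suc (suc (suc (suc zero)))

Mon : Set
Mon = Vec ℕ 5

Term : Set
Term = ℚ × Mon

Poly : Set
Poly = List Term

var : Var → Mon
var i = tabulate (λ j → if eqFin i j then 1 else 0)
  where
  eqFin : {n : ℕ} → Fin n → Fin n → Bool
  eqFin zero zero = true
  eqFin (suc a) (suc b) = eqFin a b
  eqFin _ _ = false

unitMon : Mon
unitMon = 0 ∷ 0 ∷ 0 ∷ 0 ∷ 0 ∷ []

_·M_ : Mon → Mon → Mon
_·M_ = zipWith _+_

eqMon : {n : ℕ} → Vec ℕ n → Vec ℕ n → Bool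
eqMon [] [] = true
eqMon (a ∷ as) (b ∷ bs) = (a ≡ᵇ b) ∧ eqMon as bs

ℕ→ℚ : ℕ → ℚ
ℕ→ℚ n = + n / 1

coeff : Poly → Mon → ℚ
coeff [] m = 0ℚ
coeff ((c , a) ∷ p) m = (if eqMon a m then c else 0ℚ) +ℚ coeff p m

_≈P_ : Poly → Poly → Set
p ≈P q = ∀ m → coeff p m ≡ coeff q m

_·P_ : Poly → Poly → Poly
p ·P q = concatMap (λ t → map (λ u → (proj₁ t *ℚ proj₁ u , proj₂ t ·M proj₂ u)) q) p

-- By the Leibniz rule and linearity, the unique
-- such derivation acts on a term  c · ∏ x_i^{a_i}  as
--   Σ_i  c a_i · (∏ x_j^{a_j}) / x_i · D(x_i).

Dgen : Var → Mon
Dgen zero = 1 ∷ 0 ∷ 0 ∷ 0 ∷ 1 ∷ []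
Dgen (suc zero) = 0 ∷ 1 ∷ 1 ∷ 0 ∷ 0 ∷ []
Dgen (suc (suc zero)) = 0 ∷ 0 ∷ 0 ∷ 1 ∷ 1 ∷ []
Dgen (suc (suc (suc zero))) = 0 ∷ 0 ∷ 0 ∷ 1 ∷ 1 ∷ []
Dgen (suc (suc (suc (suc zero)))) = 0 ∷ 0 ∷ 0 ∷ 1 ∷ 1 ∷ []

DTerm : Term → Poly
DTerm (c , a) =
  map (λ i → (c *ℚ ℕ→ℚ (lookup a i) , updateAt a i (λ k → k ∸ 1) ·M Dgen i))
      (toList (allFin 5))

D : Poly → Poly
D = concatMap DTerm

iterate : ℕ → (Poly → Poly) → Poly → Poly
iterate zero f p = p
iterate (suc n) f p = f (iterate n f p)

-- Permutations of [n] = {1,…,n} in one-line notation: words π(1)…π(n)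
-- of length n with letters in [n], all letters distinct.

words : ℕ → ℕ → List (List ℕ)
words n zero = [] ∷ []
words n (suc k) = concatMap (λ w → map (λ v → suc v ∷ w) (upTo n)) (words n k)

notIn : ℕ → List ℕ → Bool
notIn a [] = true
notIn a (b ∷ w) = not (a ≡ᵇ b) ∧ notIn a w

distinct : List ℕ → Bool
distinct [] = true
distinct (a ∷ w) = notIn a w ∧ distinct w

perms : ℕ → List (List ℕ)
perms n = filter (λ w → Data.Bool._≟_ (distinct w) true) (words n n)
  where import Data.Bool

countAdj : (ℕ → ℕ → Bool) → List ℕ → ℕ
countAdj R [] = 0
countAdj R (a ∷ []) = 0
countAdj R (a ∷ b ∷ w) = (if R a b then 1 else 0) + countAdj R (b ∷ w)

des suc' basc : List ℕ → ℕ
des  = countAdj (λ a b → b <ᵇ a)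
suc' = countAdj (λ a b → b ≡ᵇ suc a)
basc = countAdj (λ a b → suc a <ᵇ b)

A : ℕ → Poly
A n = map (λ π → (1ℚ , 0 ∷ 0 ∷ suc' π ∷ basc π ∷ des π ∷ [])) (perms n)

LM : Poly
LM = (1ℚ , 1 ∷ 1 ∷ 0 ∷ 0 ∷ 0 ∷ []) ∷ []

-- D sends a monomial to the sum, over its variable occurrences x, of the
-- monomial with x replaced by D(x).  Label the k+1 gaps of π ∈ 𝔖_k: the gap in
-- front by L, the gap after k by M, and the gap after any other letter a by s, x
-- or y according as a is followed by a+1, by a larger letter, or by a smaller
-- letter or nothing.  The labels multiply to the weight L M s^suc x^basc y^des
-- of π, and inserting k+1 into a gap labelled v replaces v by D(v) in the
-- weight.  Since every permutation of [k+1] arises exactly once by such an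
-- insertion, D(L M A_k) = L M A_{k+1}, and induction on n gives the theorem
-- (D is well defined on polynomials, i.e. respects equality of coefficients).

module Submission where

open import Defs
open import Algebra.Bundles using (CommutativeMonoid)
open import Data.Bool using (true; false; if_then_else_; _∧_)
import Data.Bool
open import Data.Empty using (⊥-elim)
open import Data.Fin using (Fin; zero; suc)
open import Data.Integer as ℤ using (+_)
import Data.Integer.Properties as ℤₚ
open import Data.List using (List; []; _∷_; _++_; map; concatMap; replicate; foldr; downFrom; upTo; drop; length)
import Data.List.Properties as Listₚ
open import Data.List.Membership.Propositional using (_∈_; _∉_; find)
open import Data.List.Membership.Propositional.Properties
  using (∈-map⁺; ∈-map⁻; ∈-concatMap⁺; ∈-concatMap⁻; ∈-upTo⁺; ∈-upTo⁻; ∈-downFrom⁺; ∈-downFrom⁻; ∈-∃++; ∈-filter⁺; ∈-filter⁻)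
open import Data.List.Membership.Propositional.Properties.WithK using (unique∧set⇒bag)
open import Data.List.Relation.Binary.BagAndSetEquality using (∼bag⇒↭)
open import Data.List.Relation.Binary.Permutation.Propositional as ↭ using (_↭_; ↭⇒↭ₛ; module PermutationReasoning)
import Data.List.Relation.Binary.Permutation.Propositional.Properties as ↭ₚ
import Data.List.Relation.Binary.Permutation.Setoid.Properties as ↭ₛₚ
open import Data.List.Relation.Binary.Pointwise as Pointwise using (Pointwise; []; _∷_)
open import Data.List.Relation.Unary.All as All using (All; []; _∷_)
import Data.List.Relation.Unary.All.Properties as Allₚ
open import Data.List.Relation.Unary.Any as Any using (here; there)
open import Data.List.Relation.Unary.Unique.Propositional using (Unique; []; _∷_)
import Data.List.Relation.Unary.Unique.Propositional.Properties as Uniqueₚ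
open import Data.Nat as ℕ using (ℕ; zero; suc; _+_; _∸_; _<_; _≤_; _≡ᵇ_; _<ᵇ_; z<s)
import Data.Nat.Coprimality as Coprimality
import Data.Nat.Properties as ℕₚ
open import Data.List.Membership.DecPropositional ℕₚ._≟_ using (_∈?_)
open import Data.Product using (∃; _×_; _,_)
open import Data.Rational using (ℚ; 0ℚ; 1ℚ; mkℚ; toℚᵘ) renaming (_+_ to _+ℚ_; _*_ to _*ℚ_)
import Data.Rational.Properties as ℚₚ
open import Data.Rational.Solver using (module +-*-Solver)
import Data.Rational.Unnormalised as ℚᵘ
import Data.Rational.Unnormalised.Properties as ℚᵘₚ
open import Data.Vec as Vec using (Vec; []; _∷_; lookup; updateAt; zipWith; toList; allFin)
import Data.Vec.Properties as Vecₚ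
open import Function using (_∘_; mk⇔)
open import Level using (0ℓ)
open import Relation.Binary.Bundles using (Setoid)
open import Relation.Binary.PropositionalEquality
import Relation.Binary.Reasoning.Setoid as SetoidReasoning
open import Relation.Nullary using (Dec; does; proof; Reflects; ofʸ; ofⁿ; yes; no; invert)
import Relation.Nullary.Reflects as Reflects

-- Monomials

·M-assoc : ∀ a b c → (a ·M b) ·M c ≡ a ·M (b ·M c)
·M-assoc = Vecₚ.zipWith-assoc ℕₚ.+-assoc

·M-commutativeMonoid : CommutativeMonoid 0ℓ 0ℓ
·M-commutativeMonoid = record
  { Carrier = Mon
  ; _≈_ = _≡_
  ; _∙_ = _·M_
  ; ε = unitMon
  ; isCommutativeMonoid = record
    { isMonoid = record
      { isSemigroup = record
        { isMagma = record { isEquivalence = isEquivalence ; ∙-cong = cong₂ _·M_ }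
        ; assoc = ·M-assoc }
      ; identity = Vecₚ.zipWith-identityˡ ℕₚ.+-identityˡ , Vecₚ.zipWith-identityʳ ℕₚ.+-identityʳ }
    ; comm = Vecₚ.zipWith-comm ℕₚ.+-comm
    }
  }

import Algebra.Solver.CommutativeMonoid ·M-commutativeMonoid as ·M-Solver

zipWith-+-cancelʳ : ∀ {n} {a b : Vec ℕ n} c → zipWith _+_ a c ≡ zipWith _+_ b c → a ≡ b
zipWith-+-cancelʳ {a = []} {[]} [] _ = refl
zipWith-+-cancelʳ {a = x ∷ a} {y ∷ b} (z ∷ c) eq with Vecₚ.∷-injective eq
... | x+z≡y+z , rest = cong₂ _∷_ (ℕₚ.+-cancelʳ-≡ z x y x+z≡y+z) (zipWith-+-cancelʳ c rest)

zipWith-+-∸ : ∀ {n} (x y : Vec ℕ n) → zipWith _∸_ (zipWith _+_ x y) y ≡ x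
zipWith-+-∸ [] [] = refl
zipWith-+-∸ (x ∷ xs) (y ∷ ys) = cong₂ _∷_ (ℕₚ.m+n∸n≡m x y) (zipWith-+-∸ xs ys)

≡ᵇ-reflects : ∀ m n → Reflects (m ≡ n) (m ≡ᵇ n)
≡ᵇ-reflects m n = proof (m ℕ.≟ n)

eqMon≡does : ∀ {n} (a b : Vec ℕ n) → eqMon a b ≡ does (Vecₚ.≡-dec ℕₚ._≟_ a b)
eqMon≡does [] [] = refl
eqMon≡does (x ∷ a) (y ∷ b) = cong ((x ≡ᵇ y) ∧_) (eqMon≡does a b)

eqMon-reflects : ∀ {n} (a b : Vec ℕ n) → Reflects (a ≡ b) (eqMon a b)
eqMon-reflects a b rewrite eqMon≡does a b = proof (Vecₚ.≡-dec ℕₚ._≟_ a b)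

var≡updateAt : ∀ i → var i ≡ updateAt unitMon i suc
var≡updateAt zero = refl
var≡updateAt (suc zero) = refl
var≡updateAt (suc (suc zero)) = refl
var≡updateAt (suc (suc (suc zero))) = refl
var≡updateAt (suc (suc (suc (suc zero)))) = refl

suc[∸1] : ∀ {x} → 0 < x → suc (x ∸ 1) ≡ x
suc[∸1] z<s = refl

updateAt-∸1-+-unit : ∀ {n} (i : Fin n) (a : Vec ℕ n) → 0 < lookup a i →
  zipWith _+_ (updateAt a i (_∸ 1)) (updateAt (Vec.replicate n 0) i suc) ≡ a
updateAt-∸1-+-unit zero (x ∷ a) x>0 =
  cong₂ _∷_ (trans (ℕₚ.+-comm (x ∸ 1) 1) (suc[∸1] x>0)) (Vecₚ.zipWith-identityʳ ℕₚ.+-identityʳ a)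
updateAt-∸1-+-unit (suc i) (x ∷ a) ai>0 =
  cong₂ _∷_ (ℕₚ.+-identityʳ x) (updateAt-∸1-+-unit i a ai>0)

-- ∂ i a = a / x_i · D(x_i); it is junk when x_i ∤ a, but D gives it the factor 0 then.
∂ : Var → Mon → Mon
∂ i a = updateAt a i (_∸ 1) ·M Dgen i

∂⁻¹ : Var → Mon → Mon
∂⁻¹ i m = updateAt (zipWith _∸_ m (Dgen i)) i suc

∂-·var : ∀ i a → 0 < lookup a i → ∂ i a ·M var i ≡ a ·M Dgen i
∂-·var i a ai>0 = begin
  (a⁻ ·M Dgen i) ·M var i  ≡⟨ solve 3 (λ x g v → (x ⊕ g) ⊕ v ⊜ (x ⊕ v) ⊕ g) refl a⁻ (Dgen i) (var i) ⟩
  (a⁻ ·M var i) ·M Dgen i  ≡⟨ cong (λ v → (a⁻ ·M v) ·M Dgen i) (var≡updateAt i) ⟩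
  (a⁻ ·M updateAt unitMon i suc) ·M Dgen i ≡⟨ cong (_·M Dgen i) (updateAt-∸1-+-unit i a ai>0) ⟩
  a ·M Dgen i              ∎
  where
  open ≡-Reasoning
  open ·M-Solver using (solve; _⊜_; _⊕_)
  a⁻ = updateAt a i (_∸ 1)

∂⁻¹-∂ : ∀ i a → 0 < lookup a i → ∂⁻¹ i (∂ i a) ≡ a
∂⁻¹-∂ i a ai>0 = begin
  updateAt (zipWith _∸_ (updateAt a i (_∸ 1) ·M Dgen i) (Dgen i)) i suc
    ≡⟨ cong (λ v → updateAt v i suc) (zipWith-+-∸ (updateAt a i (_∸ 1)) (Dgen i)) ⟩
  updateAt (updateAt a i (_∸ 1)) i suc  ≡⟨ Vecₚ.updateAt-updateAt i a ⟩
  updateAt a i (λ x → suc (x ∸ 1))       ≡⟨ Vecₚ.updateAt-id-local i a (suc[∸1] ai>0) ⟩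
  a                                     ∎
  where open ≡-Reasoning

allVars : List Var
allVars = toList (allFin 5)

expand : Mon → List Var
expand a = concatMap (λ i → replicate (lookup a i) i) allVars

replicate-+ : ∀ {A : Set} m n (x : A) → replicate (m + n) x ≡ replicate m x ++ replicate n x
replicate-+ zero n x = refl
replicate-+ (suc m) n x = cong (x ∷_) (replicate-+ m n x)

concatMap-++-↭ : ∀ {A B : Set} (f g : A → List B) xs →
  concatMap (λ x → f x ++ g x) xs ↭ concatMap f xs ++ concatMap g xs
concatMap-++-↭ f g [] = ↭.refl
concatMap-++-↭ {B = B} f g (x ∷ xs) = ↭.trans (↭ₚ.++⁺ˡ (f x ++ g x) (concatMap-++-↭ f g xs))
  (solve 4 (λ a b c d → (a ⊕ b) ⊕ (c ⊕ d) ⊜ (a ⊕ c) ⊕ (b ⊕ d)) ↭.refl (f x) (g x) (concatMap f xs) (concatMap g xs))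
  where open import Algebra.Solver.CommutativeMonoid (↭ₚ.++-commutativeMonoid {A = B}) using (solve; _⊜_; _⊕_)

expand-·M : ∀ u v → expand (u ·M v) ↭ expand u ++ expand v
expand-·M u v = ↭.trans
  (↭.↭-reflexive (Listₚ.concatMap-cong (λ i →
    trans (cong (λ n → replicate n i) (Vecₚ.lookup-zipWith _+_ i u v)) (replicate-+ (lookup u i) (lookup v i) i)) allVars))
  (concatMap-++-↭ (λ i → replicate (lookup u i) i) (λ i → replicate (lookup v i) i) allVars)

expand-var : ∀ i → expand (var i) ≡ i ∷ []
expand-var zero = refl
expand-var (suc zero) = refl
expand-var (suc (suc zero)) = refl
expand-var (suc (suc (suc zero))) = refl
expand-var (suc (suc (suc (suc zero)))) = refl

expand-var-·M : ∀ i v → expand (var i ·M v) ↭ i ∷ expand v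
expand-var-·M i v = ↭.trans (expand-·M (var i) v) (↭.↭-reflexive (cong (_++ expand v) (expand-var i)))

All-replicate : ∀ {A : Set} {P : A → Set} n x → (0 < n → P x) → All P (replicate n x)
All-replicate zero x _ = []
All-replicate (suc n) x P[x] = Allₚ.replicate⁺ (suc n) (P[x] z<s)

expand-positive : ∀ a → All (λ i → 0 < lookup a i) (expand a)
expand-positive a = Allₚ.concat⁺ (Allₚ.map⁺ {xs = allVars} (All.tabulate (λ {i} _ → All-replicate (lookup a i) i (λ pos → pos))))

DMon : Mon → List Mon
DMon a = map (λ i → ∂ i a) (expand a)

-- Coefficients and the derivation D

ℕ→ℚ≡mkℚ : ∀ n → ℕ→ℚ n ≡ mkℚ (+ n) 0 (Coprimality.sym (Coprimality.1-coprimeTo n))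
ℕ→ℚ≡mkℚ n = ℚₚ.normalize-coprime (Coprimality.sym (Coprimality.1-coprimeTo n))

ℕ→ℚ-+ : ∀ a b → ℕ→ℚ (a + b) ≡ ℕ→ℚ a +ℚ ℕ→ℚ b
ℕ→ℚ-+ a b = ℚₚ.toℚᵘ-injective
  (ℚᵘₚ.≃-trans toℚᵘ[a+b] (ℚᵘₚ.≃-sym (ℚₚ.toℚᵘ-homo-+ (ℕ→ℚ a) (ℕ→ℚ b))))
  where
  toℚᵘ[a+b] : toℚᵘ (ℕ→ℚ (a + b)) ℚᵘ.≃ toℚᵘ (ℕ→ℚ a) ℚᵘ.+ toℚᵘ (ℕ→ℚ b)
  toℚᵘ[a+b] rewrite ℕ→ℚ≡mkℚ (a + b) | ℕ→ℚ≡mkℚ a | ℕ→ℚ≡mkℚ b = ℚᵘ.*≡* (begin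
    + (a + b) ℤ.* + 1                         ≡⟨ ℤₚ.*-identityʳ _ ⟩
    + (a + b)                                 ≡⟨ ℤₚ.pos-+ a b ⟩
    + a ℤ.+ + b                               ≡⟨ sym (cong₂ ℤ._+_ (ℤₚ.*-identityʳ (+ a)) (ℤₚ.*-identityʳ (+ b))) ⟩
    + a ℤ.* + 1 ℤ.+ + b ℤ.* + 1               ≡⟨ sym (ℤₚ.*-identityʳ _) ⟩
    (+ a ℤ.* + 1 ℤ.+ + b ℤ.* + 1) ℤ.* + 1     ∎)
    where open ≡-Reasoning

≈P-setoid : Setoid 0ℓ 0ℓ
≈P-setoid = record
  { Carrier = Poly
  ; _≈_ = _≈P_
  ; isEquivalence = record
    { refl = λ _ → refl ; sym = λ p≈q m → sym (p≈q m) ; trans = λ p≈q q≈r m → trans (p≈q m) (q≈r m) }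
  }

coeff-++ : ∀ p q m → coeff (p ++ q) m ≡ coeff p m +ℚ coeff q m
coeff-++ [] q m = sym (ℚₚ.+-identityˡ _)
coeff-++ ((c , a) ∷ p) q m = trans (cong (x +ℚ_) (coeff-++ p q m)) (sym (ℚₚ.+-assoc x _ _))
  where x = if eqMon a m then c else 0ℚ

↭⇒≈P : ∀ {p q} → p ↭ q → p ≈P q
↭⇒≈P ↭.refl m = refl
↭⇒≈P (↭.prep (c , a) p↭q) m = cong ((if eqMon a m then c else 0ℚ) +ℚ_) (↭⇒≈P p↭q m)
↭⇒≈P (↭.swap (c , a) (d , b) p↭q) m = trans
  (cong (λ r → x +ℚ (y +ℚ r)) (↭⇒≈P p↭q m))
  (solve 3 (λ x y r → x :+ (y :+ r) := y :+ (x :+ r)) refl x y _)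
  where
  open +-*-Solver
  x = if eqMon a m then c else 0ℚ
  y = if eqMon b m then d else 0ℚ
↭⇒≈P (↭.trans p↭q q↭r) m = trans (↭⇒≈P p↭q m) (↭⇒≈P q↭r m)

if-*ˡ : ∀ b c x → (if b then c *ℚ x else 0ℚ) ≡ c *ℚ (if b then x else 0ℚ)
if-*ˡ true c x = refl
if-*ˡ false c x = sym (ℚₚ.*-zeroʳ c)

κ : Var → Mon → ℚ
κ i m = if eqMon (∂ i (∂⁻¹ i m)) m then ℕ→ℚ (lookup (∂⁻¹ i m) i) else 0ℚ

-- Only ∂⁻¹ i m can be sent to m by the i-th part of D; hence D respects _≈P_.
∂-coeff : ∀ i c a m → (if eqMon (∂ i a) m then c *ℚ ℕ→ℚ (lookup a i) else 0ℚ)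
                    ≡ (if eqMon a (∂⁻¹ i m) then c else 0ℚ) *ℚ κ i m
∂-coeff i c a m with eqMon a (∂⁻¹ i m) | eqMon-reflects a (∂⁻¹ i m)
... | true | ofʸ refl = if-*ˡ (eqMon (∂ i a) m) c _
... | false | ofⁿ a≢∂⁻¹m with eqMon (∂ i a) m | eqMon-reflects (∂ i a) m
...   | false | _ = sym (ℚₚ.*-zeroˡ (κ i m))
...   | true | ofʸ refl with lookup a i in ai≡
...     | zero = trans (ℚₚ.*-zeroʳ c) (sym (ℚₚ.*-zeroˡ (κ i m)))
...     | suc _ = ⊥-elim (a≢∂⁻¹m (sym (∂⁻¹-∂ i a (subst (0 <_) (sym ai≡) z<s))))

sumℚ : List ℚ → ℚ
sumℚ = foldr _+ℚ_ 0ℚ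

sumℚ-+ : ∀ {X : Set} (f g : X → ℚ) xs →
  sumℚ (map f xs) +ℚ sumℚ (map g xs) ≡ sumℚ (map (λ x → f x +ℚ g x) xs)
sumℚ-+ f g [] = ℚₚ.+-identityˡ 0ℚ
sumℚ-+ f g (x ∷ xs) = trans
  (solve 4 (λ a b c d → (a :+ b) :+ (c :+ d) := (a :+ c) :+ (b :+ d)) refl (f x) (sumℚ (map f xs)) (g x) (sumℚ (map g xs)))
  (cong (f x +ℚ g x +ℚ_) (sumℚ-+ f g xs))
  where open +-*-Solver

Φ : (Mon → ℚ) → Mon → ℚ
Φ f m = sumℚ (map (λ i → f (∂⁻¹ i m) *ℚ κ i m) allVars)

coeff-D : ∀ p m → coeff (D p) m ≡ Φ (coeff p) m
coeff-D [] m = sym (cong sumℚ (Listₚ.map-cong (λ i → ℚₚ.*-zeroˡ (κ i m)) allVars))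
coeff-D ((c , a) ∷ p) m = begin
  coeff (DTerm (c , a) ++ D p) m            ≡⟨ coeff-++ (DTerm (c , a)) (D p) m ⟩
  coeff (DTerm (c , a)) m +ℚ coeff (D p) m  ≡⟨ cong₂ _+ℚ_ (cong sumℚ (Listₚ.map-cong (λ i → ∂-coeff i c a m) allVars)) (coeff-D p m) ⟩
  sumℚ (map (λ i → x i *ℚ κ i m) allVars) +ℚ Φ (coeff p) m
    ≡⟨ sumℚ-+ (λ i → x i *ℚ κ i m) (λ i → coeff p (∂⁻¹ i m) *ℚ κ i m) allVars ⟩
  sumℚ (map (λ i → x i *ℚ κ i m +ℚ coeff p (∂⁻¹ i m) *ℚ κ i m) allVars)
    ≡⟨ cong sumℚ (Listₚ.map-cong (λ i → sym (ℚₚ.*-distribʳ-+ (κ i m) (x i) (coeff p (∂⁻¹ i m)))) allVars) ⟩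
  Φ (coeff ((c , a) ∷ p)) m                 ∎
  where
  open ≡-Reasoning
  x : Var → ℚ
  x i = if eqMon a (∂⁻¹ i m) then c else 0ℚ

D-cong : ∀ {p q} → p ≈P q → D p ≈P D q
D-cong {p} {q} p≈q m = begin
  coeff (D p) m    ≡⟨ coeff-D p m ⟩
  Φ (coeff p) m    ≡⟨ cong sumℚ (Listₚ.map-cong (λ i → cong (_*ℚ κ i m) (p≈q (∂⁻¹ i m))) allVars) ⟩
  Φ (coeff q) m    ≡⟨ coeff-D q m ⟨
  coeff (D q) m    ∎
  where open ≡-Reasoning

⟦_⟧ : List Mon → Poly
⟦ ms ⟧ = map (1ℚ ,_) ms

⟦⟧-++ : ∀ ms ns → ⟦ ms ++ ns ⟧ ≈P (⟦ ms ⟧ ++ ⟦ ns ⟧)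
⟦⟧-++ ms ns m = cong (λ p → coeff p m) (Listₚ.map-++ (1ℚ ,_) ms ns)

coeff-⟦replicate⟧ : ∀ n b m → coeff ⟦ replicate n b ⟧ m ≡ (if eqMon b m then ℕ→ℚ n else 0ℚ)
coeff-⟦replicate⟧ zero b m with eqMon b m
... | true = refl
... | false = refl
coeff-⟦replicate⟧ (suc n) b m rewrite coeff-⟦replicate⟧ n b m with eqMon b m
... | true = sym (ℕ→ℚ-+ 1 n)
... | false = refl

coeff-⟦map-concatMap-replicate⟧ : ∀ {X : Set} (n : X → ℕ) (f : X → Mon) xs m →
  coeff ⟦ map f (concatMap (λ x → replicate (n x) x) xs) ⟧ m
    ≡ sumℚ (map (λ x → if eqMon (f x) m then ℕ→ℚ (n x) else 0ℚ) xs)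
coeff-⟦map-concatMap-replicate⟧ n f [] m = refl
coeff-⟦map-concatMap-replicate⟧ n f (x ∷ xs) m = begin
  coeff ⟦ map f (replicate (n x) x ++ rest) ⟧ m
    ≡⟨ cong (λ ns → coeff ⟦ ns ⟧ m) (Listₚ.map-++ f (replicate (n x) x) rest) ⟩
  coeff ⟦ map f (replicate (n x) x) ++ map f rest ⟧ m
    ≡⟨ ⟦⟧-++ (map f (replicate (n x) x)) (map f rest) m ⟩
  coeff (⟦ map f (replicate (n x) x) ⟧ ++ ⟦ map f rest ⟧) m
    ≡⟨ coeff-++ ⟦ map f (replicate (n x) x) ⟧ ⟦ map f rest ⟧ m ⟩
  coeff ⟦ map f (replicate (n x) x) ⟧ m +ℚ coeff ⟦ map f rest ⟧ m
    ≡⟨ cong₂ _+ℚ_ (trans (cong (λ ns → coeff ⟦ ns ⟧ m) (Listₚ.map-replicate f (n x) x)) (coeff-⟦replicate⟧ (n x) (f x) m))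
                  (coeff-⟦map-concatMap-replicate⟧ n f xs m) ⟩
  sumℚ (map (λ x → if eqMon (f x) m then ℕ→ℚ (n x) else 0ℚ) (x ∷ xs)) ∎
  where
  open ≡-Reasoning
  rest = concatMap (λ x → replicate (n x) x) xs

DTerm≈⟦DMon⟧ : ∀ a → DTerm (1ℚ , a) ≈P ⟦ DMon a ⟧
DTerm≈⟦DMon⟧ a m = begin
  coeff (DTerm (1ℚ , a)) m
    ≡⟨ cong sumℚ (Listₚ.map-cong (λ i → cong (λ x → if eqMon (∂ i a) m then x else 0ℚ) (ℚₚ.*-identityˡ (ℕ→ℚ (lookup a i)))) allVars) ⟩
  sumℚ (map (λ i → if eqMon (∂ i a) m then ℕ→ℚ (lookup a i) else 0ℚ) allVars)
    ≡⟨ coeff-⟦map-concatMap-replicate⟧ (lookup a) (λ i → ∂ i a) allVars m ⟨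
  coeff ⟦ DMon a ⟧ m ∎
  where open ≡-Reasoning

D⟦⟧ : ∀ ms → D ⟦ ms ⟧ ≈P ⟦ concatMap DMon ms ⟧
D⟦⟧ [] m = refl
D⟦⟧ (a ∷ ms) m = begin
  coeff (DTerm (1ℚ , a) ++ D ⟦ ms ⟧) m             ≡⟨ coeff-++ (DTerm (1ℚ , a)) (D ⟦ ms ⟧) m ⟩
  coeff (DTerm (1ℚ , a)) m +ℚ coeff (D ⟦ ms ⟧) m   ≡⟨ cong₂ _+ℚ_ (DTerm≈⟦DMon⟧ a m) (D⟦⟧ ms m) ⟩
  coeff ⟦ DMon a ⟧ m +ℚ coeff ⟦ concatMap DMon ms ⟧ m ≡⟨ coeff-++ ⟦ DMon a ⟧ ⟦ concatMap DMon ms ⟧ m ⟨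
  coeff (⟦ DMon a ⟧ ++ ⟦ concatMap DMon ms ⟧) m     ≡⟨ ⟦⟧-++ (DMon a) (concatMap DMon ms) m ⟨
  coeff ⟦ concatMap DMon (a ∷ ms) ⟧ m ∎
  where open ≡-Reasoning

weight : List ℕ → Mon
weight π = 1 ∷ 1 ∷ suc' π ∷ basc π ∷ des π ∷ []

LM·A≡⟦weights⟧ : ∀ n → LM ·P A n ≡ ⟦ map weight (perms n) ⟧
LM·A≡⟦weights⟧ n = trans (Listₚ.++-identityʳ _) (trans (sym (Listₚ.map-∘ (perms n))) (Listₚ.map-∘ (perms n)))

-- The grammatical labelling of permutations

pairMon : ℕ → ℕ → Mon
pairMon a b = 0 ∷ 0 ∷ (if b ≡ᵇ suc a then 1 else 0) ∷ (if suc a <ᵇ b then 1 else 0) ∷ (if b <ᵇ a then 1 else 0) ∷ []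

pairLabel : ℕ → ℕ → Var
pairLabel a b = if b ≡ᵇ suc a then vs else if suc a <ᵇ b then vx else vy

pairMon≡var : ∀ {a b} → a ≢ b → pairMon a b ≡ var (pairLabel a b)
pairMon≡var {a} {b} a≢b
  with b ≡ᵇ suc a | ≡ᵇ-reflects b (suc a) | suc a <ᵇ b | ℕₚ.<ᵇ-reflects-< (suc a) b | b <ᵇ a | ℕₚ.<ᵇ-reflects-< b a
... | true  | ofʸ refl | false | _        | false | _       = refl
... | true  | ofʸ refl | true  | ofʸ a<a  | _     | _       = ⊥-elim (ℕₚ.<-irrefl refl a<a)
... | true  | ofʸ refl | false | _        | true  | ofʸ a<a = ⊥-elim (ℕₚ.<-asym a<a (ℕₚ.n<1+n a))
... | false | _        | true  | _        | false | _       = refl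
... | false | _        | true  | ofʸ a<b  | true  | ofʸ b<a = ⊥-elim (ℕₚ.<-asym b<a (ℕₚ.<-trans (ℕₚ.n<1+n a) a<b))
... | false | _        | false | _        | true  | _       = refl
... | false | ofⁿ b≢1+a | false | ofⁿ a+1≮b | false | ofⁿ b≮a =
  ⊥-elim (a+1≮b (ℕₚ.≤∧≢⇒< (ℕₚ.≤∧≢⇒< (ℕₚ.≮⇒≥ b≮a) a≢b) (b≢1+a ∘ sym)))

pairMon-var : ∀ {a b ℓ} → a ≢ b → pairLabel a b ≡ ℓ → pairMon a b ≡ var ℓ
pairMon-var a≢b refl = pairMon≡var a≢b

pairLabel-des : ∀ {a b} → b < a → pairLabel a b ≡ vy
pairLabel-des {a} {b} b<a with b ≡ᵇ suc a | ≡ᵇ-reflects b (suc a) | suc a <ᵇ b | ℕₚ.<ᵇ-reflects-< (suc a) b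
... | false | _        | false | _       = refl
... | true  | ofʸ refl | _     | _       = ⊥-elim (ℕₚ.<-asym b<a (ℕₚ.n<1+n a))
... | false | _        | true  | ofʸ a<b = ⊥-elim (ℕₚ.<-asym b<a (ℕₚ.<-trans (ℕₚ.n<1+n a) a<b))

pairLabel-suc : ∀ a → pairLabel a (suc a) ≡ vs
pairLabel-suc a with a ≡ᵇ a | ≡ᵇ-reflects a a
... | true  | _       = refl
... | false | ofⁿ a≢a = ⊥-elim (a≢a refl)

pairLabel-basc : ∀ {a b} → suc a < b → pairLabel a b ≡ vx
pairLabel-basc {a} {b} a+1<b with b ≡ᵇ suc a | ≡ᵇ-reflects b (suc a) | suc a <ᵇ b | ℕₚ.<ᵇ-reflects-< (suc a) b
... | true  | ofʸ refl | _     | _         = ⊥-elim (ℕₚ.<-irrefl refl a+1<b)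
... | false | _        | true  | _         = refl
... | false | _        | false | ofⁿ a+1≮b = ⊥-elim (a+1≮b a+1<b)

Dgen-pairLabel : ∀ a b → Dgen (pairLabel a b) ≡ var vx ·M var vy
Dgen-pairLabel a b with b ≡ᵇ suc a | suc a <ᵇ b
... | true  | _     = refl
... | false | true  = refl
... | false | false = refl

≤⇒≢1+ : ∀ {a k} → a ≤ k → a ≢ suc k
≤⇒≢1+ a≤k = ℕₚ.<⇒≢ (ℕ.s≤s a≤k)

pairMon-from-max : ∀ {b k} → b ≤ k → pairMon (suc k) b ≡ var vy
pairMon-from-max b≤k = pairMon-var (≤⇒≢1+ b≤k ∘ sym) (pairLabel-des (ℕ.s≤s b≤k))

insertions : ℕ → List ℕ → List (List ℕ)
insertions x [] = (x ∷ []) ∷ []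
insertions x (a ∷ π) = (x ∷ a ∷ π) ∷ map (a ∷_) (insertions x π)

nextLabel : ℕ → List ℕ → Var
nextLabel a [] = vy
nextLabel a (b ∷ _) = pairLabel a b

pairLabels : List ℕ → List Var
pairLabels [] = []
pairLabels (a ∷ w) = nextLabel a w ∷ pairLabels w

gapLabel : ℕ → ℕ → List ℕ → Var
gapLabel k a w = if a ≡ᵇ k then vM else nextLabel a w

gapLabels : ℕ → List ℕ → List Var
gapLabels k [] = []
gapLabels k (a ∷ w) = gapLabel k a w ∷ gapLabels k w

insert-front : ∀ {a k} → a ≤ k → pairMon (suc k) a ·M var vL ≡ Dgen vL
insert-front a≤k = cong (_·M var vL) (pairMon-from-max a≤k)

insert-end : ∀ {a k} → a ≤ k → pairMon a (suc k) ·M var (gapLabel k a []) ≡ Dgen (gapLabel k a [])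
insert-end {a} {k} a≤k with a ≡ᵇ k | ≡ᵇ-reflects a k
... | true | ofʸ refl = cong (_·M var vM) (pairMon-var (≤⇒≢1+ a≤k) (pairLabel-suc a))
... | false | ofⁿ a≢k = cong (_·M var vy) (pairMon-var (≤⇒≢1+ a≤k) (pairLabel-basc (ℕ.s≤s (ℕₚ.≤∧≢⇒< a≤k a≢k))))

insert-between : ∀ {a b k w} → a ≤ k → b ≤ k → a ≢ b →
  pairMon a (suc k) ·M (pairMon (suc k) b ·M var (gapLabel k a (b ∷ w)))
    ≡ pairMon a b ·M Dgen (gapLabel k a (b ∷ w))
insert-between {a} {b} {k} a≤k b≤k a≢b with a ≡ᵇ k | ≡ᵇ-reflects a k
... | true | ofʸ refl = begin
  pairMon a (suc a) ·M (pairMon (suc a) b ·M var vM)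
    ≡⟨ cong₂ (λ p q → p ·M (q ·M var vM)) (pairMon-var (≤⇒≢1+ a≤k) (pairLabel-suc a)) (pairMon-from-max b≤k) ⟩
  var vs ·M (var vy ·M var vM)   ≡⟨⟩
  var vy ·M Dgen vM              ≡⟨ cong (_·M Dgen vM) (pairMon-var a≢b (pairLabel-des (ℕₚ.≤∧≢⇒< b≤k (a≢b ∘ sym)))) ⟨
  pairMon a b ·M Dgen vM         ∎
  where open ≡-Reasoning
... | false | ofⁿ a≢k = begin
  pairMon a (suc k) ·M (pairMon (suc k) b ·M var ℓ)
    ≡⟨ cong₂ (λ p q → p ·M (q ·M var ℓ)) (pairMon-var (≤⇒≢1+ a≤k) (pairLabel-basc (ℕ.s≤s (ℕₚ.≤∧≢⇒< a≤k a≢k)))) (pairMon-from-max b≤k) ⟩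
  var vx ·M (var vy ·M var ℓ)    ≡⟨ solve 3 (λ x y l → x ⊕ (y ⊕ l) ⊜ l ⊕ (x ⊕ y)) refl (var vx) (var vy) (var ℓ) ⟩
  var ℓ ·M (var vx ·M var vy)    ≡⟨ cong₂ _·M_ (pairMon≡var a≢b) (Dgen-pairLabel a b) ⟨
  pairMon a b ·M Dgen ℓ          ∎
  where
  open ≡-Reasoning
  open ·M-Solver using (solve; _⊜_; _⊕_)
  ℓ = pairLabel a b

Pointwise-mapˡ : ∀ {A B C : Set} {R : C → B → Set} (f : A → C) {xs ys} →
  Pointwise (λ x y → R (f x) y) xs ys → Pointwise R (map f xs) ys
Pointwise-mapˡ f [] = []
Pointwise-mapˡ f (r ∷ rs) = r ∷ Pointwise-mapˡ f rs

-- Stated without division, since on a suffix of π the end gap is labelled y though there may be no descent.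
weight-insertions : ∀ k a l → All (_≤ k) (a ∷ l) → Unique (a ∷ l) →
  Pointwise (λ τ i → weight (a ∷ τ) ·M var i ≡ weight (a ∷ l) ·M Dgen i)
            (insertions (suc k) l) (gapLabels k (a ∷ l))
weight-insertions k a [] (a≤k ∷ []) _ = end ∷ []
  where
  open ·M-Solver using (solve; _⊜_; _⊕_)
  ℓ = gapLabel k a []
  end : weight (a ∷ suc k ∷ []) ·M var ℓ ≡ weight (a ∷ []) ·M Dgen ℓ
  end = trans (solve 3 (λ p w v → (p ⊕ w) ⊕ v ⊜ w ⊕ (p ⊕ v)) refl (pairMon a (suc k)) (weight (a ∷ [])) (var ℓ))
              (cong (weight (a ∷ []) ·M_) (insert-end a≤k))
weight-insertions k a (b ∷ l) (a≤k ∷ b≤k ∷ ≤k) ((a≢b ∷ _) ∷ unique) = between ∷ later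
  where
  open ·M-Solver using (solve; _⊜_; _⊕_)
  W = weight (b ∷ l)
  ℓ = gapLabel k a (b ∷ l)
  between : weight (a ∷ suc k ∷ b ∷ l) ·M var ℓ ≡ weight (a ∷ b ∷ l) ·M Dgen ℓ
  between = begin
    (pairMon a (suc k) ·M (pairMon (suc k) b ·M W)) ·M var ℓ
      ≡⟨ solve 4 (λ p q w v → (p ⊕ (q ⊕ w)) ⊕ v ⊜ (p ⊕ (q ⊕ v)) ⊕ w) refl (pairMon a (suc k)) (pairMon (suc k) b) W (var ℓ) ⟩
    (pairMon a (suc k) ·M (pairMon (suc k) b ·M var ℓ)) ·M W
      ≡⟨ cong (_·M W) (insert-between {w = l} a≤k b≤k a≢b) ⟩
    (pairMon a b ·M Dgen ℓ) ·M W
      ≡⟨ solve 3 (λ p g w → (p ⊕ g) ⊕ w ⊜ (p ⊕ w) ⊕ g) refl (pairMon a b) (Dgen ℓ) W ⟩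
    (pairMon a b ·M W) ·M Dgen ℓ ∎
    where open ≡-Reasoning
  prefix : ∀ {τ i} → weight (b ∷ τ) ·M var i ≡ W ·M Dgen i →
           weight (a ∷ b ∷ τ) ·M var i ≡ weight (a ∷ b ∷ l) ·M Dgen i
  prefix {τ} {i} eq = begin
    (pairMon a b ·M weight (b ∷ τ)) ·M var i ≡⟨ ·M-assoc (pairMon a b) (weight (b ∷ τ)) (var i) ⟩
    pairMon a b ·M (weight (b ∷ τ) ·M var i) ≡⟨ cong (pairMon a b ·M_) eq ⟩
    pairMon a b ·M (W ·M Dgen i)             ≡⟨ ·M-assoc (pairMon a b) W (Dgen i) ⟨
    (pairMon a b ·M W) ·M Dgen i             ∎
    where open ≡-Reasoning
  later = Pointwise-mapˡ (b ∷_) (Pointwise.map (λ {τ} {i} → prefix {τ} {i}) (weight-insertions k b l (b≤k ∷ ≤k) unique))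

pairLabels-expand : ∀ a w → Unique (a ∷ w) → vL ∷ vM ∷ pairLabels (a ∷ w) ↭ vy ∷ expand (weight (a ∷ w))
pairLabels-expand a [] _ = ↭ₚ.shift vy (vL ∷ vM ∷ []) []
pairLabels-expand a (b ∷ w) ((a≢b ∷ _) ∷ unique) = begin
  vL ∷ vM ∷ ℓ ∷ pairLabels (b ∷ w)        ↭⟨ ↭ₚ.shift ℓ (vL ∷ vM ∷ []) (pairLabels (b ∷ w)) ⟩
  ℓ ∷ vL ∷ vM ∷ pairLabels (b ∷ w)        ↭⟨ ↭.prep ℓ (pairLabels-expand b w unique) ⟩
  ℓ ∷ vy ∷ expand (weight (b ∷ w))        ↭⟨ ↭.swap ℓ vy ↭.refl ⟩
  vy ∷ ℓ ∷ expand (weight (b ∷ w))        ↭⟨ ↭.prep vy (expand-var-·M ℓ (weight (b ∷ w))) ⟨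
  vy ∷ expand (var ℓ ·M weight (b ∷ w))   ≡⟨ cong (λ p → vy ∷ expand (p ·M weight (b ∷ w))) (pairMon≡var a≢b) ⟨
  vy ∷ expand (weight (a ∷ b ∷ w))        ∎
  where
  open PermutationReasoning
  ℓ = pairLabel a b

gapLabel-≢ : ∀ {k a} w → a ≢ k → gapLabel k a w ≡ nextLabel a w
gapLabel-≢ {k} {a} w a≢k with a ≡ᵇ k | ≡ᵇ-reflects a k
... | false | _        = refl
... | true  | ofʸ a≡k = ⊥-elim (a≢k a≡k)

gapLabels-∉ : ∀ {k} w → All (_≢ k) w → gapLabels k w ≡ pairLabels w
gapLabels-∉ [] [] = refl
gapLabels-∉ (a ∷ w) (a≢k ∷ w≢k) = cong₂ _∷_ (gapLabel-≢ w a≢k) (gapLabels-∉ w w≢k)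

nextLabel-below : ∀ {a} w → All (_< a) w → nextLabel a w ≡ vy
nextLabel-below [] [] = refl
nextLabel-below (b ∷ w) (b<a ∷ _) = pairLabel-des b<a

-- The gap after k is a descent or the end, so its label M replaces a y of the pair labels.
gapLabels-↭ : ∀ {k} π → Unique π → All (_≤ k) π → k ∈ π → vy ∷ gapLabels k π ↭ vM ∷ pairLabels π
gapLabels-↭ {k} (a ∷ w) (a∉w ∷ unique) (a≤k ∷ w≤k) k∈π with a ≡ᵇ k | ≡ᵇ-reflects a k
... | true | ofʸ refl = begin
  vy ∷ vM ∷ gapLabels a w             ≡⟨ cong (λ ls → vy ∷ vM ∷ ls) (gapLabels-∉ w (All.map (_∘ sym) a∉w)) ⟩
  vy ∷ vM ∷ pairLabels w              ↭⟨ ↭.swap vy vM ↭.refl ⟩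
  vM ∷ vy ∷ pairLabels w              ≡⟨ cong (λ ℓ → vM ∷ ℓ ∷ pairLabels w) (nextLabel-below w w<a) ⟨
  vM ∷ nextLabel a w ∷ pairLabels w   ∎
  where
  open PermutationReasoning
  w<a = All.zipWith (λ (b≤a , a≢b) → ℕₚ.≤∧≢⇒< b≤a (a≢b ∘ sym)) (w≤k , a∉w)
... | false | ofⁿ a≢k with k∈π
...   | here k≡a = ⊥-elim (a≢k (sym k≡a))
...   | there k∈w = ↭.trans (↭.swap vy ℓ ↭.refl) (↭.trans (↭.prep ℓ (gapLabels-↭ w unique w≤k k∈w)) (↭.swap ℓ vM ↭.refl))
  where ℓ = nextLabel a w

gapLabels-expand : ∀ {k} π → Unique π → All (_≤ k) π → k ∈ π → vL ∷ gapLabels k π ↭ expand (weight π)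
gapLabels-expand {k} (a ∷ w) unique ≤k k∈π = ↭ₚ.drop-∷ (begin
  vy ∷ vL ∷ gapLabels k (a ∷ w)    ↭⟨ ↭.swap vy vL ↭.refl ⟩
  vL ∷ vy ∷ gapLabels k (a ∷ w)    ↭⟨ ↭.prep vL (gapLabels-↭ (a ∷ w) unique ≤k k∈π) ⟩
  vL ∷ vM ∷ pairLabels (a ∷ w)     ↭⟨ pairLabels-expand a w unique ⟩
  vy ∷ expand (weight (a ∷ w))     ∎)
  where open PermutationReasoning

Pointwise⇒map≡ : ∀ {A B C : Set} {P : B → Set} {R : A → B → Set} {f : A → C} {g : B → C} →
  (∀ {x y} → P y → R x y → f x ≡ g y) → ∀ {xs ys} → All P ys → Pointwise R xs ys → map f xs ≡ map g ys
Pointwise⇒map≡ conv [] [] = refl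
Pointwise⇒map≡ conv (p ∷ ps) (r ∷ rs) = cong₂ _∷_ (conv p r) (Pointwise⇒map≡ conv ps rs)

insertions-weights : ∀ {k} π → Unique π → All (_≤ k) π → k ∈ π → map weight (insertions (suc k) π) ↭ DMon (weight π)
insertions-weights {k} (a ∷ l) unique ≤k@(a≤k ∷ _) k∈π = begin
  map weight (insertions (suc k) (a ∷ l))  ≡⟨ Pointwise⇒map≡ (λ {σ} {i} → exact {σ} {i}) positive labelled ⟩
  map (λ i → ∂ i w) (vL ∷ gapLabels k (a ∷ l)) ↭⟨ ↭ₚ.map⁺ (λ i → ∂ i w) (gapLabels-expand (a ∷ l) unique ≤k k∈π) ⟩
  DMon w ∎
  where
  open PermutationReasoning
  open ·M-Solver using (solve; _⊜_; _⊕_)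
  w = weight (a ∷ l)
  front : weight (suc k ∷ a ∷ l) ·M var vL ≡ w ·M Dgen vL
  front = trans (solve 3 (λ p w v → (p ⊕ w) ⊕ v ⊜ w ⊕ (p ⊕ v)) refl (pairMon (suc k) a) w (var vL))
                (cong (w ·M_) (insert-front a≤k))
  labelled : Pointwise (λ σ i → weight σ ·M var i ≡ w ·M Dgen i) (insertions (suc k) (a ∷ l)) (vL ∷ gapLabels k (a ∷ l))
  labelled = front ∷ Pointwise-mapˡ (a ∷_) (weight-insertions k a l ≤k unique)
  positive : All (λ i → 0 < lookup w i) (vL ∷ gapLabels k (a ∷ l))
  positive = ↭ₚ.All-resp-↭ (↭.↭-sym (gapLabels-expand (a ∷ l) unique ≤k k∈π)) (expand-positive w)
  exact : ∀ {σ i} → 0 < lookup w i → weight σ ·M var i ≡ w ·M Dgen i → weight σ ≡ ∂ i w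
  exact {i = i} pos eq = zipWith-+-cancelʳ (var i) (trans eq (sym (∂-·var i w pos)))

-- Permutations of [n]

Unique-resp-↭ : ∀ {A : Set} {xs ys : List A} → xs ↭ ys → Unique xs → Unique ys
Unique-resp-↭ = ↭ₛₚ.Unique-resp-↭ (setoid _) ∘ ↭⇒↭ₛ

Unique-concatMap⁺ : ∀ {A B : Set} {f : A → List B} (g : B → A) {xs} →
  (∀ {x z} → x ∈ xs → z ∈ f x → g z ≡ x) → (∀ {x} → x ∈ xs → Unique (f x)) → Unique xs → Unique (concatMap f xs)
Unique-concatMap⁺ g {[]} _ _ _ = []
Unique-concatMap⁺ {f = f} g {x ∷ xs} g∘f uniqueᶠ (x∉xs ∷ unique) =
  Uniqueₚ.++⁺ (uniqueᶠ (here refl)) (Unique-concatMap⁺ g (g∘f ∘ there) (uniqueᶠ ∘ there) unique) disjoint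
  where
  disjoint : ∀ {z} → z ∈ f x × z ∈ concatMap f xs → _
  disjoint (z∈fx , z∈rest) with y , y∈xs , z∈fy ← find (∈-concatMap⁻ f {xs = xs} z∈rest) =
    All.lookup x∉xs y∈xs (trans (sym (g∘f (here refl) z∈fx)) (g∘f (there y∈xs) z∈fy))

concatMap-↭ : ∀ {A B : Set} {f g : A → List B} xs → (∀ {x} → x ∈ xs → f x ↭ g x) → concatMap f xs ↭ concatMap g xs
concatMap-↭ [] _ = ↭.refl
concatMap-↭ (x ∷ xs) f↭g = ↭ₚ.++⁺ (f↭g (here refl)) (concatMap-↭ xs (f↭g ∘ there))

Unique⇒++-↭ : ∀ {σ} ys → Unique σ → All (_∈ ys) σ → ∃ λ τ → σ ++ τ ↭ ys
Unique⇒++-↭ {[]} [] _ _ = [] , ↭.refl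
Unique⇒++-↭ {_ ∷ _} [] _ (() ∷ _)
Unique⇒++-↭ {σ} (y ∷ ys) unique σ⊆ with y ∈? σ
... | no y∉σ with τ , σ++τ↭ys ← Unique⇒++-↭ ys unique (All.tabulate (λ a∈σ → Any.tail (λ { refl → y∉σ a∈σ }) (All.lookup σ⊆ a∈σ)))
  = y ∷ τ , ↭.trans (↭ₚ.shift y σ τ) (↭.prep y σ++τ↭ys)
... | yes y∈σ with pre , post , refl ← ∈-∃++ y∈σ
  with y∉rest ∷ unique′ ← Unique-resp-↭ (↭ₚ.shift y pre post) unique
  with _ ∷ rest⊆ ← ↭ₚ.All-resp-↭ (↭ₚ.shift y pre post) σ⊆
  with τ , rest++τ↭ys ← Unique⇒++-↭ ys unique′ (All.zipWith (λ (a∈ , y≢a) → Any.tail (y≢a ∘ sym) a∈) (rest⊆ , y∉rest))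
  = τ , ↭.trans (↭ₚ.++⁺ʳ τ (↭ₚ.shift y pre post)) (↭.prep y rest++τ↭ys)

range : ℕ → List ℕ
range n = map suc (downFrom n)

length-range : ∀ n → length (range n) ≡ n
length-range n = trans (Listₚ.length-map suc (downFrom n)) (Listₚ.length-downFrom n)

suc∈range : ∀ {v n} → v < n → suc v ∈ range n
suc∈range v<n = ∈-map⁺ suc (∈-downFrom⁺ v<n)

∈-range⁻ : ∀ {a n} → a ∈ range n → ∃ λ v → v < n × a ≡ suc v
∈-range⁻ a∈ with v , v∈ , refl ← ∈-map⁻ suc a∈ = v , ∈-downFrom⁻ v∈ , refl

∈-range⇒≤ : ∀ {a n} → a ∈ range n → a ≤ n
∈-range⇒≤ a∈ with _ , v<n , refl ← ∈-range⁻ a∈ = v<n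

range-unique : ∀ n → Unique (range n)
range-unique n = Uniqueₚ.map⁺ ℕₚ.suc-injective (Uniqueₚ.downFrom⁺ n)

∈-words⁻ : ∀ n k {w} → w ∈ words n k → length w ≡ k × All (_∈ range n) w
∈-words⁻ n zero (here refl) = refl , []
∈-words⁻ n (suc k) w∈ with w′ , w′∈ , w∈map ← find (∈-concatMap⁻ (λ w → map (λ v → suc v ∷ w) (upTo n)) {xs = words n k} w∈)
                     with v , v∈ , refl ← ∈-map⁻ (λ v → suc v ∷ w′) w∈map
                     with len , all ← ∈-words⁻ n k w′∈
  = cong suc len , suc∈range (∈-upTo⁻ v∈) ∷ all

∈-words⁺ : ∀ n k {w} → length w ≡ k → All (_∈ range n) w → w ∈ words n k
∈-words⁺ n zero {[]} refl [] = here refl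
∈-words⁺ n (suc k) {a ∷ w} len (a∈ ∷ all) with v , v<n , refl ← ∈-range⁻ a∈ =
  ∈-concatMap⁺ (λ w → map (λ v → suc v ∷ w) (upTo n)) {xs = words n k}
    (Any.map (λ { refl → ∈-map⁺ (λ v → suc v ∷ w) (∈-upTo⁺ v<n) }) (∈-words⁺ n k (ℕₚ.suc-injective len) all))

words-unique : ∀ n k → Unique (words n k)
words-unique n zero = [] ∷ []
words-unique n (suc k) = Unique-concatMap⁺ (drop 1) tail≡ (λ _ → Uniqueₚ.map⁺ head-injective (Uniqueₚ.upTo⁺ n)) (words-unique n k)
  where
  tail≡ : ∀ {w z} → w ∈ words n k → z ∈ map (λ v → suc v ∷ w) (upTo n) → drop 1 z ≡ w
  tail≡ {w} _ z∈ with _ , _ , refl ← ∈-map⁻ (λ v → suc v ∷ w) z∈ = refl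
  head-injective : ∀ {w : List ℕ} {u v : ℕ} → suc u ∷ w ≡ suc v ∷ w → u ≡ v
  head-injective refl = refl

notIn-reflects : ∀ a w → Reflects (All (a ≢_) w) (notIn a w)
notIn-reflects a [] = ofʸ []
notIn-reflects a (b ∷ w) with a ≡ᵇ b | ≡ᵇ-reflects a b | notIn a w | notIn-reflects a w
... | true  | ofʸ refl | _     | _         = ofⁿ λ { (a≢a ∷ _) → a≢a refl }
... | false | ofⁿ a≢b | true  | ofʸ a∉w   = ofʸ (a≢b ∷ a∉w)
... | false | _       | false | ofⁿ ¬a∉w  = ofⁿ λ { (_ ∷ a∉w) → ¬a∉w a∉w }

distinct-reflects : ∀ w → Reflects (Unique w) (distinct w)
distinct-reflects [] = ofʸ []
distinct-reflects (a ∷ w) with notIn a w | notIn-reflects a w | distinct w | distinct-reflects w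
... | true  | ofʸ a∉w  | true  | ofʸ unique  = ofʸ (a∉w ∷ unique)
... | true  | _        | false | ofⁿ ¬unique = ofⁿ λ { (_ ∷ unique) → ¬unique unique }
... | false | ofⁿ ¬a∉w | _     | _           = ofⁿ λ { (a∉w ∷ _) → ¬a∉w a∉w }

distinct? : ∀ w → Dec (distinct w ≡ true)
distinct? w = distinct w Data.Bool.≟ true

∈-perms⁻ : ∀ {n σ} → σ ∈ perms n → σ ↭ range n
∈-perms⁻ {n} {σ} σ∈ with σ∈words , distinct≡true ← ∈-filter⁻ distinct? {xs = words n n} σ∈
                    with len , σ⊆ ← ∈-words⁻ n n σ∈words
                    with τ , σ++τ↭ ← Unique⇒++-↭ (range n) (invert (subst (Reflects _) distinct≡true (distinct-reflects σ))) σ⊆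
  = ↭.trans (↭.↭-reflexive (sym (Listₚ.++-identityʳ σ))) (subst (λ τ → σ ++ τ ↭ range n) (τ≡[] τ lengths) σ++τ↭)
  where
  lengths : length σ ℕ.+ length τ ≡ length σ
  lengths = trans (sym (Listₚ.length-++ σ)) (trans (↭ₚ.↭-length σ++τ↭) (trans (length-range n) (sym len)))
  τ≡[] : ∀ τ → length σ ℕ.+ length τ ≡ length σ → τ ≡ []
  τ≡[] [] _ = refl
  τ≡[] (_ ∷ _) eq = ⊥-elim (ℕₚ.m+1+n≢m (length σ) eq)

∈-perms⁺ : ∀ {n σ} → σ ↭ range n → σ ∈ perms n
∈-perms⁺ {n} {σ} σ↭ = ∈-filter⁺ distinct? (∈-words⁺ n n (trans (↭ₚ.↭-length σ↭) (length-range n)) σ⊆)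
  (Reflects.det (distinct-reflects σ) (ofʸ (Unique-resp-↭ (↭.↭-sym σ↭) (range-unique n))))
  where σ⊆ = ↭ₚ.All-resp-↭ (↭.↭-sym σ↭) (All.tabulate (λ a∈ → a∈))

perms-unique : ∀ n → Unique (perms n)
perms-unique n = Uniqueₚ.filter⁺ distinct? (words-unique n n)

insertions-↭ : ∀ {x σ} π → σ ∈ insertions x π → σ ↭ x ∷ π
insertions-↭ [] (here refl) = ↭.refl
insertions-↭ (a ∷ π) (here refl) = ↭.refl
insertions-↭ {x} (a ∷ π) (there σ∈) with σ′ , σ′∈ , refl ← ∈-map⁻ (a ∷_) σ∈ =
  ↭.trans (↭.prep a (insertions-↭ π σ′∈)) (↭.swap a x ↭.refl)

∈-insertions⁺ : ∀ x pre post → pre ++ x ∷ post ∈ insertions x (pre ++ post)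
∈-insertions⁺ x [] [] = here refl
∈-insertions⁺ x [] (_ ∷ _) = here refl
∈-insertions⁺ x (a ∷ pre) post = there (∈-map⁺ (a ∷_) (∈-insertions⁺ x pre post))

insertions-unique : ∀ {x} π → x ∉ π → Unique (insertions x π)
insertions-unique [] _ = [] ∷ []
insertions-unique {x} (a ∷ π) x∉ =
  All.tabulate front≢ ∷ Uniqueₚ.map⁺ (λ { refl → refl }) (insertions-unique π (x∉ ∘ there))
  where
  front≢ : ∀ {σ} → σ ∈ map (a ∷_) (insertions x π) → x ∷ a ∷ π ≢ σ
  front≢ σ∈ eq with _ , _ , refl ← ∈-map⁻ (a ∷_) σ∈ with refl ← eq = x∉ (here refl)

remove : ℕ → List ℕ → List ℕ
remove x [] = []
remove x (a ∷ w) = if a ≡ᵇ x then w else a ∷ remove x w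

remove-head : ∀ x w → remove x (x ∷ w) ≡ w
remove-head x w with x ≡ᵇ x | ≡ᵇ-reflects x x
... | true  | _       = refl
... | false | ofⁿ x≢x = ⊥-elim (x≢x refl)

remove-insertions : ∀ {x σ} π → x ∉ π → σ ∈ insertions x π → remove x σ ≡ π
remove-insertions {x} [] _ (here refl) = remove-head x []
remove-insertions {x} (a ∷ π) _ (here refl) = remove-head x (a ∷ π)
remove-insertions {x} (a ∷ π) x∉ (there σ∈) with σ′ , σ′∈ , refl ← ∈-map⁻ (a ∷_) σ∈ with a ≡ᵇ x | ≡ᵇ-reflects a x
... | true  | ofʸ refl = ⊥-elim (x∉ (here refl))
... | false | _        = cong (a ∷_) (remove-insertions π (x∉ ∘ there) σ′∈)

max∉perms : ∀ {k π} → π ∈ perms k → suc k ∉ π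
max∉perms π∈ k+1∈π = ℕₚ.<-irrefl refl (∈-range⇒≤ (↭ₚ.∈-resp-↭ (∈-perms⁻ π∈) k+1∈π))

perms-suc-↭ : ∀ k → perms (suc k) ↭ concatMap (insertions (suc k)) (perms k)
perms-suc-↭ k = ∼bag⇒↭ (unique∧set⇒bag (perms-unique (suc k)) unique (mk⇔ to from))
  where
  N = suc k
  unique : Unique (concatMap (insertions N) (perms k))
  unique = Unique-concatMap⁺ (remove N) (λ π∈ → remove-insertions _ (max∉perms π∈))
             (λ π∈ → insertions-unique _ (max∉perms π∈)) (perms-unique k)
  max∈ : ∀ {σ} → σ ∈ perms N → N ∈ σ
  max∈ σ∈ = ↭ₚ.∈-resp-↭ (↭.↭-sym (∈-perms⁻ σ∈)) (here refl)
  to : ∀ {σ} → σ ∈ perms N → σ ∈ concatMap (insertions N) (perms k)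
  to σ∈ with pre , post , refl ← ∈-∃++ (max∈ σ∈) =
    ∈-concatMap⁺ (insertions N) {xs = perms k} (Any.map (λ { refl → ∈-insertions⁺ N pre post }) (∈-perms⁺ rest↭))
    where rest↭ = ↭ₚ.drop-∷ (↭.trans (↭.↭-sym (↭ₚ.shift N pre post)) (∈-perms⁻ σ∈))
  from : ∀ {σ} → σ ∈ concatMap (insertions N) (perms k) → σ ∈ perms N
  from σ∈ with π , π∈ , σ∈ins ← find (∈-concatMap⁻ (insertions N) {xs = perms k} σ∈) =
    ∈-perms⁺ (↭.trans (insertions-↭ π σ∈ins) (↭.prep N (∈-perms⁻ π∈)))

DMon-weights-perms : ∀ k → concatMap DMon (map weight (perms (suc k))) ↭ map weight (perms (suc (suc k)))
DMon-weights-perms k = begin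
  concatMap DMon (map weight (perms (suc k)))                           ≡⟨ Listₚ.concatMap-map DMon weight (perms (suc k)) ⟩
  concatMap (DMon ∘ weight) (perms (suc k))                             ↭⟨ concatMap-↭ (perms (suc k)) weights ⟨
  concatMap (map weight ∘ insertions (suc (suc k))) (perms (suc k))     ≡⟨ Listₚ.map-concatMap weight (insertions (suc (suc k))) (perms (suc k)) ⟨
  map weight (concatMap (insertions (suc (suc k))) (perms (suc k)))     ↭⟨ ↭ₚ.map⁺ weight (perms-suc-↭ (suc k)) ⟨
  map weight (perms (suc (suc k)))                                      ∎
  where
  open PermutationReasoning
  weights : ∀ {π} → π ∈ perms (suc k) → map weight (insertions (suc (suc k)) π) ↭ DMon (weight π)
  weights {π} π∈ = insertions-weights π (Unique-resp-↭ (↭.↭-sym π↭) (range-unique (suc k)))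
    (↭ₚ.All-resp-↭ (↭.↭-sym π↭) (All.tabulate ∈-range⇒≤)) (↭ₚ.∈-resp-↭ (↭.↭-sym π↭) (here refl))
    where π↭ = ∈-perms⁻ π∈

mainTheorem13 : (n : ℕ) → iterate n D LM ≈P (LM ·P A (suc n))
mainTheorem13 zero _ = refl
mainTheorem13 (suc n) = begin
  D (iterate n D LM)                              ≈⟨ D-cong {iterate n D LM} {LM ·P A (suc n)} (mainTheorem13 n) ⟩
  D (LM ·P A (suc n))                             ≡⟨ cong D (LM·A≡⟦weights⟧ (suc n)) ⟩
  D ⟦ map weight (perms (suc n)) ⟧                ≈⟨ D⟦⟧ (map weight (perms (suc n))) ⟩
  ⟦ concatMap DMon (map weight (perms (suc n))) ⟧ ≈⟨ ↭⇒≈P (↭ₚ.map⁺ (1ℚ ,_) (DMon-weights-perms n)) ⟩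
  ⟦ map weight (perms (suc (suc n))) ⟧            ≡⟨ LM·A≡⟦weights⟧ (suc (suc n)) ⟨
  LM ·P A (suc (suc n))                           ∎
  where open SetoidReasoning ≈P-setoid
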